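{- Let $\lambda$ be a real number. (i) If $\{A_n\}_{n\ge0}$ is an even sequence, then $$\sum_{k=0}^{2n+1}\binom{2n-\lambda}{2n+1-k}\binom{\lambda}{k}2^kA_k=0\quad(n=0,1,2,\ldots).$$ (ii) If $\{A_n\}_{n\ge0}$ is an odd sequence, then $$\sum_{k=0}^{2n}\binom{2n-1-\lambda}{2n-k}\binom{\lambda}{k}2^kA_k=0\quad(n=0,1,2,\ldots).$$
   Context: A sequence $\{a_n\}_{n\ge0}$ of real (or complex) numbers is called an even sequence if $\sum_{k=0}^n\binom nk(-1)^ka_k=a_n$ for all $n=0,1,2,\ldots$, and an odd sequence if $\sum_{k=0}^n\binom nk(-1)^ka_k=-a_n$ for all $n=0,1,2,\ldots$. For real $x$ and a nonnegative integer $k$, $\binom xk=x(x-1)\cdots(x-k+1)/k!$ (with $\binom x0=1$). -}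

module Defs where

open import Level using (Level)
open import Algebra.Bundles using (CommutativeRing)
open import Data.Nat as ℕ using (ℕ; zero; suc)
open import Data.Nat.Combinatorics using (_C_)

private variable c ℓ : Level

module _ (R : CommutativeRing c ℓ) where
  open CommutativeRing R

  fromℕ : ℕ → Carrier
  fromℕ zero = 0#
  fromℕ (suc n) = 1# + fromℕ n

  sign : ℕ → Carrier
  sign zero = 1#
  sign (suc k) = - sign k

  sumTo : ℕ → (ℕ → Carrier) → Carrier
  sumTo zero f = f 0
  sumTo (suc n) f = sumTo n f + f (suc n)

  IsEvenSeq : (ℕ → Carrier) → Set ℓ
  IsEvenSeq a = ∀ n → sumTo n (λ k → fromℕ (n C k) * sign k * a k) ≈ a n

  IsOddSeq : (ℕ → Carrier) → Set ℓ
  IsOddSeq a = ∀ n → sumTo n (λ k → fromℕ (n C k) * sign k * a k) ≈ - a n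

  -- generalized binomial coefficient  binom x k = x(x-1)...(x-k+1)/k!,
  -- where inv j is a (given) inverse of the element j+1 of R.
  binom : (ℕ → Carrier) → Carrier → ℕ → Carrier
  binom inv x zero = 1#
  binom inv x (suc k) = binom inv x k * (x - fromℕ k) * inv k

module Submission where

open import Algebra.Bundles using (CommutativeRing)
open import Data.Maybe using (Maybe; nothing; just)
open import Data.Nat as ℕ using (ℕ; zero; suc; _∸_; _^_; _≤_; _<_; z≤n; s≤s; _!)
import Data.Nat.Properties as ℕP
open import Data.Nat.Combinatorics
  using (_C_; nCk≡n!/k![n-k]!; k![n∸k]!∣n!; nCk+nC[k+1]≡[n+1]C[k+1]; k>n⇒nCk≡0)
open import Data.Nat.DivMod using (m/n*n≡m)
open import Data.Integer as ℤ using (ℤ; +_; -[1+_]; _⊖_)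
import Data.Integer.Properties as ℤP
open import Data.Sign as Sign using (Sign)
open import Data.Product using (_×_; _,_)
open import Relation.Nullary using (yes; no)
open import Relation.Binary.PropositionalEquality as P using (_≡_)
open import Defs

-- Write N for the upper index (N = 2n+1 in part (i), N = 2n in
-- part (ii)), so that the upper argument of the first binomial is N-1-λ.
--  * Upper negation and the product rule for generalised binomials give
--      binom(N-1-λ, N-k) binom(λ,k) = (-1)^(N-k) binom(λ,N) C(N,k),
--    so the sum equals (-1)^N binom(λ,N) · W(a), W(a) = Σ_k C(N,k) (-2)^k a_k.
--  * Writing T for the binomial transform (T a)_n = Σ_k C(n,k) (-1)^k a_k,
--    the convolution identity Σ_k C(N,k) C(k,m) (-2)^k = (-1)^N C(N,m) 2^m
--    (induction on N via Pascal's rule) yields W(T a) = (-1)^N W(a).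
--  * For an even (odd) sequence T a = a (T a = -a), so with N odd (even) this
--    reads W(a) = -W(a); as 2 is invertible (inv 1 is its inverse), W(a) = 0.
-- The file first builds the ring solver with integer coefficients for an
-- arbitrary commutative ring, then develops sums, signs, the convolution
-- identity, the transform identity, and falling factorials / generalised
-- binomials; the corollary combines the two vanishing statements.

choose-factorials : ∀ k r → ((k ℕ.+ r) C k) ℕ.* (k ! ℕ.* r !) ≡ (k ℕ.+ r) !
choose-factorials k r = begin
  ((k ℕ.+ r) C k) ℕ.* (k ! ℕ.* r !)              ≡⟨ P.cong (λ j → ((k ℕ.+ r) C k) ℕ.* (k ! ℕ.* j !)) (ℕP.m+n∸m≡n k r) ⟨
  ((k ℕ.+ r) C k) ℕ.* (k ! ℕ.* (k ℕ.+ r ∸ k) !)  ≡⟨ P.cong (ℕ._* (k ! ℕ.* (k ℕ.+ r ∸ k) !)) (nCk≡n!/k![n-k]! k≤k+r) ⟩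
  _                                              ≡⟨ m/n*n≡m {{ℕP._!*_!≢0 k (k ℕ.+ r ∸ k)}} (k![n∸k]!∣n! k≤k+r) ⟩
  (k ℕ.+ r) !                                    ∎
  where
  open P.≡-Reasoning
  k≤k+r : k ≤ k ℕ.+ r
  k≤k+r = ℕP.m≤m+n k r

-- The unique ring map ℤ → R, n ↦ n·1, is a homomorphism; this is exactly
-- what the standard library's ring solver needs to normalise expressions
-- with integer constants (and subtraction) in R.
module IntegerRingSolver {c ℓ} (R : CommutativeRing c ℓ) where
  open CommutativeRing R
  open import Algebra.Properties.Ring ring
    using (-0#≈0#; -‿involutive; -‿+-comm; -‿anti-homo-+; xyx⁻¹≈y; -1*x≈-x)
  open import Algebra.Properties.CommutativeSemigroup *-commutativeSemigroup
    using (interchange)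
  open import Algebra.Properties.Semiring.Mult.TCOptimised semiring
    using (1+×; ×-homo-+; ×1-homo-*) renaming (_×_ to _·_)
  open import Algebra.Solver.Ring.AlmostCommutativeRing
    using (fromCommutativeRing; _-Raw-AlmostCommutative⟶_)
  open import Relation.Binary.Reasoning.Setoid setoid

  -- n · 1# ∈ R; this version of _·_ has 0 · 1# = 0# and 1 · 1# = 1# definitionally,
  -- so the solver's constants 0 and 1 are literally 0# and 1#
  natural : ℕ → Carrier
  natural n = n · 1#

  signed : Sign → Carrier
  signed Sign.+ = 1#
  signed Sign.- = - 1#

  integer : ℤ → Carrier
  integer (+ n)    = natural n
  integer -[1+ n ] = - natural (suc n)

  integer-⊖ : ∀ m n → integer (m ⊖ n) ≈ natural m - natural n
  integer-⊖ zero    zero    = sym (-‿inverseʳ 0#)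
  integer-⊖ zero    (suc n) = sym (+-identityˡ _)
  integer-⊖ (suc m) zero    = sym (trans (+-congˡ -0#≈0#) (+-identityʳ _))
  integer-⊖ (suc m) (suc n) = begin
    integer (suc m ⊖ suc n)                     ≡⟨ P.cong integer (ℤP.[1+m]⊖[1+n]≡m⊖n m n) ⟩
    integer (m ⊖ n)                             ≈⟨ integer-⊖ m n ⟩
    a - b                                       ≈⟨ xyx⁻¹≈y 1# (a - b) ⟨
    1# + (a - b) - 1#                           ≈⟨ +-congʳ (+-assoc 1# a (- b)) ⟨
    1# + a - b - 1#                             ≈⟨ +-assoc (1# + a) (- b) (- 1#) ⟩
    1# + a + (- b - 1#)                         ≈⟨ +-cong (1+× m 1#) (-‿anti-homo-+ 1# b) ⟨
    natural (suc m) - (1# + b)                  ≈⟨ +-congˡ (-‿cong (1+× n 1#)) ⟨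
    natural (suc m) - natural (suc n)           ∎
    where
    a b : Carrier
    a = natural m
    b = natural n

  integer-+ : ∀ i j → integer (i ℤ.+ j) ≈ integer i + integer j
  integer-+ (+ m)    (+ n)    = ×-homo-+ 1# m n
  integer-+ (+ m)    -[1+ n ] = integer-⊖ m (suc n)
  integer-+ -[1+ m ] (+ n)    = trans (integer-⊖ n (suc m)) (+-comm _ _)
  integer-+ -[1+ m ] -[1+ n ] = begin
    - natural (suc (suc (m ℕ.+ n)))             ≡⟨ P.cong (λ k → - natural (suc k)) (ℕP.+-suc m n) ⟨
    - natural (suc m ℕ.+ suc n)                 ≈⟨ -‿cong (×-homo-+ 1# (suc m) (suc n)) ⟩
    - (natural (suc m) + natural (suc n))       ≈⟨ -‿+-comm _ _ ⟨
    - natural (suc m) - natural (suc n)         ∎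

  signed-* : ∀ s t → signed (s Sign.* t) ≈ signed s * signed t
  signed-* Sign.+ t      = sym (*-identityˡ _)
  signed-* Sign.- Sign.+ = sym (*-identityʳ _)
  signed-* Sign.- Sign.- = sym (trans (-1*x≈-x (- 1#)) (-‿involutive 1#))

  integer-◃ : ∀ s n → integer (s ℤ.◃ n) ≈ signed s * natural n
  integer-◃ s      zero    = sym (zeroʳ _)
  integer-◃ Sign.+ (suc n) = sym (*-identityˡ _)
  integer-◃ Sign.- (suc n) = sym (-1*x≈-x _)

  integer-signAbs : ∀ i → integer i ≈ signed (ℤ.sign i) * natural ℤ.∣ i ∣
  integer-signAbs (+ n)    = sym (*-identityˡ _)
  integer-signAbs -[1+ n ] = sym (-1*x≈-x _)

  integer-* : ∀ i j → integer (i ℤ.* j) ≈ integer i * integer j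
  integer-* i j = begin
    integer (i ℤ.* j)                           ≈⟨ integer-◃ (ℤ.sign i Sign.* ℤ.sign j) (ℤ.∣ i ∣ ℕ.* ℤ.∣ j ∣) ⟩
    signed (ℤ.sign i Sign.* ℤ.sign j) * natural (ℤ.∣ i ∣ ℕ.* ℤ.∣ j ∣)
      ≈⟨ *-cong (signed-* (ℤ.sign i) (ℤ.sign j)) (×1-homo-* ℤ.∣ i ∣ ℤ.∣ j ∣) ⟩
    (signed (ℤ.sign i) * signed (ℤ.sign j)) * (natural ℤ.∣ i ∣ * natural ℤ.∣ j ∣)
      ≈⟨ interchange _ _ _ _ ⟩
    (signed (ℤ.sign i) * natural ℤ.∣ i ∣) * (signed (ℤ.sign j) * natural ℤ.∣ j ∣)
      ≈⟨ *-cong (integer-signAbs i) (integer-signAbs j) ⟨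
    integer i * integer j                       ∎

  integer-neg : ∀ i → integer (ℤ.- i) ≈ - integer i
  integer-neg (+ zero)    = sym -0#≈0#
  integer-neg (+ suc n)   = refl
  integer-neg -[1+ n ]    = sym (-‿involutive _)

  homomorphism : ℤ.+-*-rawRing -Raw-AlmostCommutative⟶ fromCommutativeRing R
  homomorphism = record
    { ⟦_⟧ = integer ; +-homo = integer-+ ; *-homo = integer-* ; -‿homo = integer-neg
    ; 0-homo = refl ; 1-homo = refl }

  coefficients-equal? : ∀ i j → Maybe (integer i ≈ integer j)
  coefficients-equal? i j with i ℤ.≟ j
  ... | yes P.refl = just refl
  ... | no _       = nothing

  open import Algebra.Solver.Ring ℤ.+-*-rawRing (fromCommutativeRing R) homomorphism coefficients-equal? public

module BinomialTransform {c ℓ} (R : CommutativeRing c ℓ) where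
  open CommutativeRing R
  open import Algebra.Properties.Ring ring using (-‿distribˡ-*; -1*x≈-x)
  open import Algebra.Properties.CommutativeSemigroup +-commutativeSemigroup
    using () renaming (interchange to +-interchange)
  open import Algebra.Properties.CommutativeSemigroup *-commutativeSemigroup
    using () renaming (interchange to *-interchange)
  open import Algebra.Properties.Semiring.Mult semiring
    using () renaming (_×_ to _·_; ×-homo-+ to ·-homo-+; ×1-homo-* to ·1-homo-*)
  open import Relation.Binary.Reasoning.Setoid setoid
  open IntegerRingSolver R using (Polynomial; solve; _:=_; _:+_; _:*_; _:-_; :-_; con)

  ι : ℕ → Carrier
  ι = fromℕ R

  sg : ℕ → Carrier
  sg = sign R

  Σ : ℕ → (ℕ → Carrier) → Carrier
  Σ = sumTo R

  -- the solver expression whose meaning is (definitionally) ι 2 = 1# + (1# + 0#)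
  :two : ∀ {n} → Polynomial n
  :two = con (+ 1) :+ (con (+ 1) :+ con (+ 0))

  -- ι agrees with the library's repeated addition n · 1#, so it is a semiring map
  ι≡·1 : ∀ n → ι n ≡ n · 1#
  ι≡·1 zero    = P.refl
  ι≡·1 (suc n) = P.cong (λ x → 1# + x) (ι≡·1 n)

  ι-+ : ∀ m n → ι (m ℕ.+ n) ≈ ι m + ι n
  ι-+ m n rewrite ι≡·1 (m ℕ.+ n) | ι≡·1 m | ι≡·1 n = ·-homo-+ 1# m n

  ι-* : ∀ m n → ι (m ℕ.* n) ≈ ι m * ι n
  ι-* m n rewrite ι≡·1 (m ℕ.* n) | ι≡·1 m | ι≡·1 n = ·1-homo-* m n

  ι-1 : ι 1 ≈ 1#
  ι-1 = +-identityʳ 1#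

  sg-+ : ∀ a b → sg (a ℕ.+ b) ≈ sg a * sg b
  sg-+ zero    b = sym (*-identityˡ _)
  sg-+ (suc a) b = trans (-‿cong (sg-+ a b)) (-‿distribˡ-* _ _)

  sg-square : ∀ a → sg a * sg a ≈ 1#
  sg-square zero    = *-identityˡ 1#
  sg-square (suc a) = begin
    - sg a * - sg a   ≈⟨ solve 1 (λ s → :- s :* :- s := s :* s) refl (sg a) ⟩
    sg a * sg a       ≈⟨ sg-square a ⟩
    1#                ∎

  sg-double : ∀ n → sg (2 ℕ.* n) ≈ 1#
  sg-double n = begin
    sg (n ℕ.+ (n ℕ.+ 0))   ≡⟨ P.cong (λ m → sg (n ℕ.+ m)) (ℕP.+-identityʳ n) ⟩
    sg (n ℕ.+ n)           ≈⟨ sg-+ n n ⟩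
    sg n * sg n            ≈⟨ sg-square n ⟩
    1#                     ∎

  sg-∸ : ∀ {k N} → k ≤ N → sg (N ∸ k) ≈ sg N * sg k
  sg-∸ {k} {N} k≤N = begin
    sg r                   ≈⟨ *-identityˡ (sg r) ⟨
    1# * sg r              ≈⟨ *-congʳ (sg-square k) ⟨
    sg k * sg k * sg r     ≈⟨ solve 2 (λ a b → a :* a :* b := a :* b :* a) refl (sg k) (sg r) ⟩
    sg k * sg r * sg k     ≈⟨ *-congʳ (sg-+ k r) ⟨
    sg (k ℕ.+ r) * sg k    ≡⟨ P.cong (λ m → sg m * sg k) (ℕP.m+[n∸m]≡n k≤N) ⟩
    sg N * sg k            ∎
    where
    r : ℕ
    r = N ∸ k

  Σ-cong≤ : ∀ n {f g : ℕ → Carrier} → (∀ k → k ≤ n → f k ≈ g k) → Σ n f ≈ Σ n g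
  Σ-cong≤ zero    f≈g = f≈g 0 z≤n
  Σ-cong≤ (suc n) f≈g =
    +-cong (Σ-cong≤ n (λ k k≤n → f≈g k (ℕP.m≤n⇒m≤1+n k≤n))) (f≈g (suc n) ℕP.≤-refl)

  Σ-cong : ∀ n {f g : ℕ → Carrier} → (∀ k → f k ≈ g k) → Σ n f ≈ Σ n g
  Σ-cong n f≈g = Σ-cong≤ n (λ k _ → f≈g k)

  Σ-+ : ∀ n (f g : ℕ → Carrier) → Σ n (λ k → f k + g k) ≈ Σ n f + Σ n g
  Σ-+ zero    f g = refl
  Σ-+ (suc n) f g = trans (+-congʳ (Σ-+ n f g)) (+-interchange _ _ _ _)

  Σ-*ˡ : ∀ n a (f : ℕ → Carrier) → Σ n (λ k → a * f k) ≈ a * Σ n f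
  Σ-*ˡ zero    a f = refl
  Σ-*ˡ (suc n) a f = trans (+-congʳ (Σ-*ˡ n a f)) (sym (distribˡ _ _ _))

  Σ-*ʳ : ∀ n a (f : ℕ → Carrier) → Σ n (λ k → f k * a) ≈ Σ n f * a
  Σ-*ʳ n a f = trans (Σ-cong n (λ k → *-comm _ _)) (trans (Σ-*ˡ n a f) (*-comm _ _))

  Σ-shift : ∀ n (f : ℕ → Carrier) → Σ (suc n) f ≈ f 0 + Σ n (λ k → f (suc k))
  Σ-shift zero    f = refl
  Σ-shift (suc n) f = trans (+-congʳ (Σ-shift n f)) (+-assoc _ _ _)

  Σ-swap : ∀ n m (f : ℕ → ℕ → Carrier) →
    Σ n (λ k → Σ m (λ j → f k j)) ≈ Σ m (λ j → Σ n (λ k → f k j))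
  Σ-swap zero    m f = refl
  Σ-swap (suc n) m f = trans (+-congʳ (Σ-swap n m f)) (sym (Σ-+ m _ _))

  Σ-extend : ∀ {n N} (f : ℕ → Carrier) → n ≤ N → (∀ k → n < k → f k ≈ 0#) → Σ N f ≈ Σ n f
  Σ-extend {n} {N} f n≤N tail≈0 = begin
    Σ N f                 ≡⟨ P.cong (λ M → Σ M f) (ℕP.m+[n∸m]≡n n≤N) ⟨
    Σ (n ℕ.+ (N ∸ n)) f   ≈⟨ extend (N ∸ n) ⟩
    Σ n f                 ∎
    where
    extend : ∀ d → Σ (n ℕ.+ d) f ≈ Σ n f
    extend zero    = reflexive (P.cong (λ M → Σ M f) (ℕP.+-identityʳ n))
    extend (suc d) = begin
      Σ (n ℕ.+ suc d) f                    ≡⟨ P.cong (λ M → Σ M f) (ℕP.+-suc n d) ⟩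
      Σ (n ℕ.+ d) f + f (suc (n ℕ.+ d))    ≈⟨ +-cong (extend d) (tail≈0 _ (s≤s (ℕP.m≤m+n n d))) ⟩
      Σ n f + 0#                           ≈⟨ +-identityʳ _ ⟩
      Σ n f                                ∎

  Σ-pascal : ∀ N (φ : ℕ → Carrier) →
    Σ (suc N) (λ k → ι (suc N C k) * φ k) ≈ Σ N (λ k → ι (N C k) * φ k) + Σ N (λ k → ι (N C k) * φ (suc k))
  Σ-pascal N φ = begin
    Σ (suc N) (λ k → ι (suc N C k) * φ k)               ≈⟨ Σ-shift N _ ⟩
    g 0 + Σ N (λ k → ι (suc N C suc k) * φ (suc k))     ≈⟨ +-congˡ (Σ-cong N split) ⟩
    g 0 + Σ N (λ k → h k + g (suc k))                   ≈⟨ +-congˡ (Σ-+ N h _) ⟩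
    g 0 + (Σ N h + Σ N (λ k → g (suc k)))
      ≈⟨ solve 3 (λ a b c → a :+ (b :+ c) := (a :+ c) :+ b) refl (g 0) (Σ N h) _ ⟩
    (g 0 + Σ N (λ k → g (suc k))) + Σ N h               ≈⟨ +-congʳ (Σ-shift N g) ⟨
    (Σ N g + g (suc N)) + Σ N h                         ≈⟨ +-congʳ (+-congˡ last≈0) ⟩
    (Σ N g + 0#) + Σ N h                                ≈⟨ +-congʳ (+-identityʳ _) ⟩
    Σ N g + Σ N h                                       ∎
    where
    g h : ℕ → Carrier
    g k = ι (N C k) * φ k
    h k = ι (N C k) * φ (suc k)
    split : ∀ k → ι (suc N C suc k) * φ (suc k) ≈ h k + g (suc k)
    split k = begin
      ι (suc N C suc k) * φ (suc k)                    ≡⟨ P.cong (λ m → ι m * φ (suc k)) (nCk+nC[k+1]≡[n+1]C[k+1] N k) ⟨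
      ι (N C k ℕ.+ N C suc k) * φ (suc k)              ≈⟨ *-congʳ (ι-+ (N C k) (N C suc k)) ⟩
      (ι (N C k) + ι (N C suc k)) * φ (suc k)          ≈⟨ distribʳ _ _ _ ⟩
      h k + g (suc k)                                  ∎
    last≈0 : g (suc N) ≈ 0#
    last≈0 = begin
      ι (N C suc N) * φ (suc N)   ≡⟨ P.cong (λ m → ι m * φ (suc N)) (k>n⇒nCk≡0 (ℕP.n<1+n N)) ⟩
      0# * φ (suc N)              ≈⟨ zeroˡ _ ⟩
      0#                          ∎

  -- (-2)^k, written with the factors that occur in the theorem
  negTwoPow : ℕ → Carrier
  negTwoPow k = sg k * ι (2 ^ k)

  negTwoPow-suc : ∀ k → negTwoPow (suc k) ≈ - ι 2 * negTwoPow k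
  negTwoPow-suc k = begin
    - sg k * ι (2 ℕ.* 2 ^ k)        ≈⟨ *-congˡ (ι-* 2 (2 ^ k)) ⟩
    - sg k * (ι 2 * ι (2 ^ k))      ≈⟨ solve 3 (λ s t p → :- s :* (t :* p) := :- t :* (s :* p)) refl (sg k) (ι 2) (ι (2 ^ k)) ⟩
    - ι 2 * negTwoPow k             ∎

  convolution : ℕ → ℕ → Carrier
  convolution N m = Σ N (λ k → ι (N C k) * (ι (k C m) * negTwoPow k))

  convolution-suc : ∀ N m → convolution (suc N) m ≈
    convolution N m + - ι 2 * Σ N (λ k → ι (N C k) * (ι (suc k C m) * negTwoPow k))
  convolution-suc N m = begin
    convolution (suc N) m
      ≈⟨ Σ-pascal N (λ k → ι (k C m) * negTwoPow k) ⟩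
    convolution N m + Σ N (λ k → ι (N C k) * (ι (suc k C m) * negTwoPow (suc k)))
      ≈⟨ +-congˡ (Σ-cong N pull) ⟩
    convolution N m + Σ N (λ k → - ι 2 * (ι (N C k) * (ι (suc k C m) * negTwoPow k)))
      ≈⟨ +-congˡ (Σ-*ˡ N (- ι 2) _) ⟩
    convolution N m + - ι 2 * Σ N (λ k → ι (N C k) * (ι (suc k C m) * negTwoPow k)) ∎
    where
    pull : ∀ k → ι (N C k) * (ι (suc k C m) * negTwoPow (suc k))
               ≈ - ι 2 * (ι (N C k) * (ι (suc k C m) * negTwoPow k))
    pull k = trans (*-congˡ (*-congˡ (negTwoPow-suc k)))
      (solve 4 (λ a b t p → a :* (b :* (:- t :* p)) := :- t :* (a :* (b :* p))) refl _ _ (ι 2) _)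

  convolution-shifted : ∀ N m →
    Σ N (λ k → ι (N C k) * (ι (suc k C suc m) * negTwoPow k)) ≈ convolution N m + convolution N (suc m)
  convolution-shifted N m = trans (Σ-cong N split) (Σ-+ N _ _)
    where
    split : ∀ k → ι (N C k) * (ι (suc k C suc m) * negTwoPow k)
                ≈ ι (N C k) * (ι (k C m) * negTwoPow k) + ι (N C k) * (ι (k C suc m) * negTwoPow k)
    split k = begin
      ι (N C k) * (ι (suc k C suc m) * negTwoPow k)
        ≡⟨ P.cong (λ j → ι (N C k) * (ι j * negTwoPow k)) (nCk+nC[k+1]≡[n+1]C[k+1] k m) ⟨
      ι (N C k) * (ι (k C m ℕ.+ k C suc m) * negTwoPow k)
        ≈⟨ *-congˡ (*-congʳ (ι-+ (k C m) (k C suc m))) ⟩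
      ι (N C k) * ((ι (k C m) + ι (k C suc m)) * negTwoPow k)
        ≈⟨ solve 4 (λ a x y p → a :* ((x :+ y) :* p) := a :* (x :* p) :+ a :* (y :* p)) refl _ _ _ _ ⟩
      ι (N C k) * (ι (k C m) * negTwoPow k) + ι (N C k) * (ι (k C suc m) * negTwoPow k) ∎

  convolution-value : ∀ N m → convolution N m ≈ sg N * (ι (N C m) * ι (2 ^ m))
  convolution-value zero zero = trans (*-congʳ ι-1) (*-congˡ (*-congˡ (*-identityˡ _)))
  convolution-value zero (suc m) =
    trans (*-congˡ (zeroˡ _)) (trans (zeroʳ _) (sym (trans (*-congˡ (zeroˡ _)) (zeroʳ _))))
  convolution-value (suc N) zero = begin
    convolution (suc N) 0                   ≈⟨ convolution-suc N 0 ⟩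
    convolution N 0 + - ι 2 * convolution N 0
      ≈⟨ +-cong (convolution-value N 0) (*-congˡ (convolution-value N 0)) ⟩
    sg N * x + - ι 2 * (sg N * x)
      ≈⟨ solve 2 (λ s x → s :* x :+ :- :two :* (s :* x) := :- s :* x) refl (sg N) x ⟩
    - sg N * x                              ∎
    where
    x : Carrier
    x = ι 1 * ι 1
  convolution-value (suc N) (suc m) = begin
    convolution (suc N) (suc m)
      ≈⟨ convolution-suc N (suc m) ⟩
    convolution N (suc m) + - ι 2 * Σ N (λ k → ι (N C k) * (ι (suc k C suc m) * negTwoPow k))
      ≈⟨ +-congˡ (*-congˡ (convolution-shifted N m)) ⟩
    convolution N (suc m) + - ι 2 * (convolution N m + convolution N (suc m))
      ≈⟨ +-cong (convolution-value N (suc m))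
                (*-congˡ (+-cong (convolution-value N m) (convolution-value N (suc m)))) ⟩
    sg N * (b * ι (2 ℕ.* p)) + - ι 2 * (sg N * (a * ι p) + sg N * (b * ι (2 ℕ.* p)))
      ≈⟨ +-cong (*-congˡ (*-congˡ (ι-* 2 p))) (*-congˡ (+-congˡ (*-congˡ (*-congˡ (ι-* 2 p))))) ⟩
    sg N * (b * (ι 2 * ι p)) + - ι 2 * (sg N * (a * ι p) + sg N * (b * (ι 2 * ι p)))
      ≈⟨ solve 4 (λ s a b p → s :* (b :* (:two :* p)) :+ :- :two :* (s :* (a :* p) :+ s :* (b :* (:two :* p)))
                             := :- s :* ((a :+ b) :* (:two :* p))) refl (sg N) a b (ι p) ⟩
    - sg N * ((a + b) * (ι 2 * ι p))
      ≈⟨ *-congˡ (*-cong (ι-+ (N C m) (N C suc m)) (ι-* 2 p)) ⟨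
    - sg N * (ι (N C m ℕ.+ N C suc m) * ι (2 ℕ.* p))
      ≡⟨ P.cong (λ j → - sg N * (ι j * ι (2 ℕ.* p))) (nCk+nC[k+1]≡[n+1]C[k+1] N m) ⟩
    - sg N * (ι (suc N C suc m) * ι (2 ℕ.* p)) ∎
    where
    a b : Carrier
    a = ι (N C m)
    b = ι (N C suc m)
    p : ℕ
    p = 2 ^ m

  transform : (ℕ → Carrier) → ℕ → Carrier
  transform a n = Σ n (λ k → ι (n C k) * sg k * a k)

  weighted : ℕ → (ℕ → Carrier) → Carrier
  weighted N a = Σ N (λ k → ι (N C k) * negTwoPow k * a k)

  -- Key identity: weighting commutes with the transform up to the sign (-1)^N.
  -- Expand T a, swap the double sum and evaluate the inner sum by convolution-value.
  weighted-transform : ∀ N a → weighted N (transform a) ≈ sg N * weighted N a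
  weighted-transform N a = begin
    Σ N (λ k → w k * transform a k)
      ≈⟨ Σ-cong≤ N (λ k k≤N → *-congˡ (Σ-extend (t k) k≤N (t-vanishes k))) ⟨
    Σ N (λ k → w k * Σ N (t k))                       ≈⟨ Σ-cong N (λ k → Σ-*ˡ N (w k) (t k)) ⟨
    Σ N (λ k → Σ N (λ m → w k * t k m))               ≈⟨ Σ-swap N N _ ⟩
    Σ N (λ m → Σ N (λ k → w k * t k m))
      ≈⟨ Σ-cong N (λ m → trans (Σ-cong N (λ k → regroup k m)) (Σ-*ʳ N _ _)) ⟩
    Σ N (λ m → convolution N m * (sg m * a m))
      ≈⟨ Σ-cong N (λ m → *-congʳ (convolution-value N m)) ⟩
    Σ N (λ m → sg N * (ι (N C m) * ι (2 ^ m)) * (sg m * a m))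
      ≈⟨ Σ-cong N (λ m → solve 5 (λ s c p r x → s :* (c :* p) :* (r :* x) := s :* (c :* (r :* p) :* x))
                                 refl (sg N) (ι (N C m)) (ι (2 ^ m)) (sg m) (a m)) ⟩
    Σ N (λ m → sg N * (w m * a m))                    ≈⟨ Σ-*ˡ N (sg N) _ ⟩
    sg N * weighted N a                               ∎
    where
    w : ℕ → Carrier
    w k = ι (N C k) * negTwoPow k
    t : ℕ → ℕ → Carrier
    t k m = ι (k C m) * sg m * a m
    t-vanishes : ∀ k m → k < m → t k m ≈ 0#
    t-vanishes k m k<m = begin
      ι (k C m) * sg m * a m   ≡⟨ P.cong (λ j → ι j * sg m * a m) (k>n⇒nCk≡0 k<m) ⟩
      0# * sg m * a m          ≈⟨ trans (*-congʳ (zeroˡ _)) (zeroˡ _) ⟩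
      0#                       ∎
    regroup : ∀ k m → w k * t k m ≈ ι (N C k) * (ι (k C m) * negTwoPow k) * (sg m * a m)
    regroup k m = solve 5 (λ c p b s x → c :* p :* (b :* s :* x) := c :* (b :* p) :* (s :* x))
                          refl (ι (N C k)) (negTwoPow k) (ι (k C m)) (sg m) (a m)

  self-negative⇒0 : ∀ {half} → ι 2 * half ≈ 1# → ∀ s → s ≈ - s → s ≈ 0#
  self-negative⇒0 {half} 2*half≈1 s s≈-s = begin
    s                     ≈⟨ *-identityʳ s ⟨
    s * 1#                ≈⟨ *-congˡ 2*half≈1 ⟨
    s * (ι 2 * half)      ≈⟨ solve 2 (λ s h → s :* (:two :* h) := (s :+ s) :* h) refl s half ⟩
    (s + s) * half        ≈⟨ *-congʳ (+-congˡ s≈-s) ⟩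
    (s - s) * half        ≈⟨ *-congʳ (-‿inverseʳ s) ⟩
    0# * half             ≈⟨ zeroˡ half ⟩
    0#                    ∎

  -- If T a = (-1)^e a and (-1)^(e+N) = -1, then Σ_k C(N,k)(-2)^k a_k = 0
  -- (e = 0, N odd: even sequences; e = 1, N even: odd sequences).
  weighted-vanishes : ∀ {half} → ι 2 * half ≈ 1# →
    ∀ e a → (∀ k → transform a k ≈ sg e * a k) → ∀ N → sg e * sg N ≈ - 1# → weighted N a ≈ 0#
  weighted-vanishes 2*half≈1 e a Ta≈±a N signs = self-negative⇒0 2*half≈1 S S≈-S
    where
    S : Carrier
    S = weighted N a
    eS≈NS : sg e * S ≈ sg N * S
    eS≈NS = begin
      sg e * S                                          ≈⟨ Σ-*ˡ N (sg e) _ ⟨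
      Σ N (λ k → sg e * (ι (N C k) * negTwoPow k * a k))
        ≈⟨ Σ-cong N (λ k → solve 3 (λ s w x → s :* (w :* x) := w :* (s :* x)) refl (sg e) (ι (N C k) * negTwoPow k) (a k)) ⟩
      weighted N (λ k → sg e * a k)                     ≈⟨ Σ-cong N (λ k → *-congˡ (Ta≈±a k)) ⟨
      weighted N (transform a)                          ≈⟨ weighted-transform N a ⟩
      sg N * S                                          ∎
    S≈-S : S ≈ - S
    S≈-S = begin
      S                         ≈⟨ *-identityˡ S ⟨
      1# * S                    ≈⟨ *-congʳ (sg-square e) ⟨
      sg e * sg e * S           ≈⟨ *-assoc _ _ _ ⟩
      sg e * (sg e * S)         ≈⟨ *-congˡ eS≈NS ⟩
      sg e * (sg N * S)         ≈⟨ *-assoc _ _ _ ⟨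
      sg e * sg N * S           ≈⟨ *-congʳ signs ⟩
      - 1# * S                  ≈⟨ -1*x≈-x S ⟩
      - S                       ∎

  falling : Carrier → ℕ → Carrier
  falling x zero    = 1#
  falling x (suc k) = falling x k * (x - ι k)

  falling-cong : ∀ {x y} → x ≈ y → ∀ k → falling x k ≈ falling y k
  falling-cong x≈y zero    = refl
  falling-cong x≈y (suc k) = *-cong (falling-cong x≈y k) (+-congʳ x≈y)

  falling-+ : ∀ x k r → falling x (k ℕ.+ r) ≈ falling x k * falling (x - ι k) r
  falling-+ x k zero = begin
    falling x (k ℕ.+ 0)      ≡⟨ P.cong (falling x) (ℕP.+-identityʳ k) ⟩
    falling x k              ≈⟨ *-identityʳ _ ⟨
    falling x k * 1#         ∎
  falling-+ x k (suc r) = begin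
    falling x (k ℕ.+ suc r)                         ≡⟨ P.cong (falling x) (ℕP.+-suc k r) ⟩
    falling x (k ℕ.+ r) * (x - ι (k ℕ.+ r))         ≈⟨ *-cong (falling-+ x k r) (+-congˡ (-‿cong (ι-+ k r))) ⟩
    falling x k * falling (x - ι k) r * (x - (ι k + ι r))
      ≈⟨ solve 5 (λ a b x p q → a :* b :* (x :- (p :+ q)) := a :* (b :* ((x :- p) :- q)))
                 refl (falling x k) (falling (x - ι k) r) x (ι k) (ι r) ⟩
    falling x k * (falling (x - ι k) r * ((x - ι k) - ι r)) ∎

  -- reflection  (r-1-y)^{(r)} = (-1)^r y^{(r)}: the factors r-1-y-j are -(y-(r-1-j)) in reverse order
  falling-reflect : ∀ r y → falling (ι r - 1# - y) r ≈ sg r * falling y r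
  falling-reflect zero    y = sym (*-identityˡ _)
  falling-reflect (suc r) y = begin
    falling z (1 ℕ.+ r)                            ≈⟨ falling-+ z 1 r ⟩
    falling z 1 * falling (z - ι 1) r
      ≈⟨ *-congˡ (falling-cong (solve 2 (λ a y → (con (+ 1) :+ a) :- con (+ 1) :- y :- (con (+ 1) :+ con (+ 0))
                                               := a :- con (+ 1) :- y) refl (ι r) y) r) ⟩
    falling z 1 * falling (ι r - 1# - y) r         ≈⟨ *-congˡ (falling-reflect r y) ⟩
    falling z 1 * (sg r * falling y r)
      ≈⟨ solve 4 (λ a y s f → con (+ 1) :* ((con (+ 1) :+ a) :- con (+ 1) :- y :- con (+ 0)) :* (s :* f)
                             := :- s :* (f :* (y :- a))) refl (ι r) y (sg r) (falling y r) ⟩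
    - sg r * (falling y r * (y - ι r))             ∎
    where
    z : Carrier
    z = ι (suc r) - 1# - y

  module GeneralisedBinomial (inv : ℕ → Carrier) (inv-spec : ∀ j → ι (suc j) * inv j ≈ 1#) where

    binomial : Carrier → ℕ → Carrier
    binomial = binom R inv

    invFactorial : ℕ → Carrier
    invFactorial zero    = 1#
    invFactorial (suc k) = invFactorial k * inv k

    invFactorial-inverse : ∀ n → ι (n !) * invFactorial n ≈ 1#
    invFactorial-inverse zero    = trans (*-identityʳ _) ι-1
    invFactorial-inverse (suc n) = begin
      ι (suc n ℕ.* n !) * (invFactorial n * inv n)        ≈⟨ *-congʳ (ι-* (suc n) (n !)) ⟩
      ι (suc n) * ι (n !) * (invFactorial n * inv n)
        ≈⟨ solve 4 (λ a b c d → a :* b :* (c :* d) := (b :* c) :* (a :* d)) refl _ _ _ _ ⟩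
      (ι (n !) * invFactorial n) * (ι (suc n) * inv n)    ≈⟨ *-cong (invFactorial-inverse n) (inv-spec n) ⟩
      1# * 1#                                             ≈⟨ *-identityˡ 1# ⟩
      1#                                                  ∎

    invFactorial-+ : ∀ k r → invFactorial k * invFactorial r ≈ invFactorial (k ℕ.+ r) * ι ((k ℕ.+ r) C k)
    invFactorial-+ k r = begin
      a * b                                  ≈⟨ *-identityʳ _ ⟨
      a * b * 1#                             ≈⟨ *-congˡ (invFactorial-inverse (k ℕ.+ r)) ⟨
      a * b * (ι ((k ℕ.+ r) !) * n⁻¹)        ≈⟨ *-congˡ (*-congʳ factorials) ⟨
      a * b * ((χ * (ι (k !) * ι (r !))) * n⁻¹)
        ≈⟨ solve 7 (λ a b n p q u w → a :* b :* ((w :* (p :* q)) :* n) := (p :* a) :* (q :* b) :* (n :* w))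
                   refl a b n⁻¹ (ι (k !)) (ι (r !)) (ι ((k ℕ.+ r) !)) χ ⟩
      (ι (k !) * a) * (ι (r !) * b) * (n⁻¹ * χ)
        ≈⟨ *-congʳ (*-cong (invFactorial-inverse k) (invFactorial-inverse r)) ⟩
      1# * 1# * (n⁻¹ * χ)                    ≈⟨ trans (*-congʳ (*-identityˡ 1#)) (*-identityˡ _) ⟩
      n⁻¹ * χ                                ∎
      where
      a b n⁻¹ χ : Carrier
      a = invFactorial k
      b = invFactorial r
      n⁻¹ = invFactorial (k ℕ.+ r)
      χ = ι ((k ℕ.+ r) C k)
      factorials : χ * (ι (k !) * ι (r !)) ≈ ι ((k ℕ.+ r) !)
      factorials = begin
        χ * (ι (k !) * ι (r !))                  ≈⟨ *-congˡ (ι-* (k !) (r !)) ⟨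
        χ * ι (k ! ℕ.* r !)                      ≈⟨ ι-* ((k ℕ.+ r) C k) (k ! ℕ.* r !) ⟨
        ι (((k ℕ.+ r) C k) ℕ.* (k ! ℕ.* r !))    ≡⟨ P.cong ι (choose-factorials k r) ⟩
        ι ((k ℕ.+ r) !)                          ∎

    binomial≈falling : ∀ x k → binomial x k ≈ falling x k * invFactorial k
    binomial≈falling x zero    = sym (*-identityˡ _)
    binomial≈falling x (suc k) = begin
      binomial x k * (x - ι k) * inv k                  ≈⟨ *-congʳ (*-congʳ (binomial≈falling x k)) ⟩
      falling x k * invFactorial k * (x - ι k) * inv k
        ≈⟨ solve 4 (λ f i y v → f :* i :* y :* v := f :* y :* (i :* v)) refl _ _ _ _ ⟩
      falling x k * (x - ι k) * (invFactorial k * inv k) ∎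

    binomial-cong : ∀ {x y} → x ≈ y → ∀ k → binomial x k ≈ binomial y k
    binomial-cong x≈y k =
      trans (binomial≈falling _ k) (trans (*-congʳ (falling-cong x≈y k)) (sym (binomial≈falling _ k)))

    binomial-product : ∀ lam k r →
      binomial lam k * binomial (lam - ι k) r ≈ binomial lam (k ℕ.+ r) * ι ((k ℕ.+ r) C k)
    binomial-product lam k r = begin
      binomial lam k * binomial (lam - ι k) r
        ≈⟨ *-cong (binomial≈falling lam k) (binomial≈falling (lam - ι k) r) ⟩
      falling lam k * invFactorial k * (falling (lam - ι k) r * invFactorial r)
        ≈⟨ *-interchange _ _ _ _ ⟩
      falling lam k * falling (lam - ι k) r * (invFactorial k * invFactorial r)
        ≈⟨ *-cong (sym (falling-+ lam k r)) (invFactorial-+ k r) ⟩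
      falling lam (k ℕ.+ r) * (invFactorial (k ℕ.+ r) * ι ((k ℕ.+ r) C k))
        ≈⟨ *-assoc _ _ _ ⟨
      falling lam (k ℕ.+ r) * invFactorial (k ℕ.+ r) * ι ((k ℕ.+ r) C k)
        ≈⟨ *-congʳ (binomial≈falling lam (k ℕ.+ r)) ⟨
      binomial lam (k ℕ.+ r) * ι ((k ℕ.+ r) C k) ∎

    binomial-reflect : ∀ r y → binomial (ι r - 1# - y) r ≈ sg r * binomial y r
    binomial-reflect r y = begin
      binomial (ι r - 1# - y) r                 ≈⟨ binomial≈falling _ r ⟩
      falling (ι r - 1# - y) r * invFactorial r ≈⟨ *-congʳ (falling-reflect r y) ⟩
      sg r * falling y r * invFactorial r       ≈⟨ *-assoc _ _ _ ⟩
      sg r * (falling y r * invFactorial r)     ≈⟨ *-congˡ (binomial≈falling y r) ⟨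
      sg r * binomial y r                       ∎

    binomial-complement : ∀ lam {k N} → k ≤ N →
      binomial (ι N - 1# - lam) (N ∸ k) * binomial lam k ≈ sg (N ∸ k) * (binomial lam N * ι (N C k))
    binomial-complement lam {k} {N} k≤N =
      P.subst (λ M → binomial (ι M - 1# - lam) r * binomial lam k ≈ sg r * (binomial lam M * ι (M C k)))
              (ℕP.m+[n∸m]≡n k≤N) complement
      where
      r : ℕ
      r = N ∸ k
      complement : binomial (ι (k ℕ.+ r) - 1# - lam) r * binomial lam k
                 ≈ sg r * (binomial lam (k ℕ.+ r) * ι ((k ℕ.+ r) C k))
      complement = begin
        binomial (ι (k ℕ.+ r) - 1# - lam) r * binomial lam k
          ≈⟨ *-congʳ (binomial-cong shift r) ⟩
        binomial (ι r - 1# - (lam - ι k)) r * binomial lam k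
          ≈⟨ *-congʳ (binomial-reflect r (lam - ι k)) ⟩
        sg r * binomial (lam - ι k) r * binomial lam k
          ≈⟨ solve 3 (λ s b a → s :* b :* a := s :* (a :* b)) refl (sg r) _ _ ⟩
        sg r * (binomial lam k * binomial (lam - ι k) r)
          ≈⟨ *-congˡ (binomial-product lam k r) ⟩
        sg r * (binomial lam (k ℕ.+ r) * ι ((k ℕ.+ r) C k)) ∎
        where
        shift : ι (k ℕ.+ r) - 1# - lam ≈ ι r - 1# - (lam - ι k)
        shift = trans (+-congʳ (+-congʳ (ι-+ k r)))
          (solve 3 (λ a b l → (a :+ b) :- con (+ 1) :- l := b :- con (+ 1) :- (l :- a)) refl (ι k) (ι r) lam)

    summand-factor : ∀ lam (a : ℕ → Carrier) {k N} → k ≤ N →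
      binomial (ι N - 1# - lam) (N ∸ k) * binomial lam k * ι (2 ^ k) * a k
        ≈ (sg N * binomial lam N) * (ι (N C k) * negTwoPow k * a k)
    summand-factor lam a {k} {N} k≤N = begin
      binomial (ι N - 1# - lam) (N ∸ k) * binomial lam k * ι (2 ^ k) * a k
        ≈⟨ *-congʳ (*-congʳ (binomial-complement lam k≤N)) ⟩
      sg (N ∸ k) * (binomial lam N * ι (N C k)) * ι (2 ^ k) * a k
        ≈⟨ *-congʳ (*-congʳ (*-congʳ (sg-∸ k≤N))) ⟩
      sg N * sg k * (binomial lam N * ι (N C k)) * ι (2 ^ k) * a k
        ≈⟨ solve 6 (λ s t b c p x → s :* t :* (b :* c) :* p :* x := (s :* b) :* (c :* (t :* p) :* x))
                   refl (sg N) (sg k) (binomial lam N) (ι (N C k)) (ι (2 ^ k)) (a k) ⟩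
      (sg N * binomial lam N) * (ι (N C k) * negTwoPow k * a k) ∎

    reflected-sum-vanishes : ∀ lam e (a : ℕ → Carrier) → (∀ k → transform a k ≈ sg e * a k) →
      ∀ N → sg e * sg N ≈ - 1# →
      Σ N (λ k → binomial (ι N - 1# - lam) (N ∸ k) * binomial lam k * ι (2 ^ k) * a k) ≈ 0#
    reflected-sum-vanishes lam e a Ta≈±a N signs = begin
      Σ N (λ k → binomial (ι N - 1# - lam) (N ∸ k) * binomial lam k * ι (2 ^ k) * a k)
        ≈⟨ Σ-cong≤ N (λ k k≤N → summand-factor lam a k≤N) ⟩
      Σ N (λ k → (sg N * binomial lam N) * (ι (N C k) * negTwoPow k * a k))
        ≈⟨ Σ-*ˡ N _ _ ⟩
      (sg N * binomial lam N) * weighted N a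
        ≈⟨ *-congˡ (weighted-vanishes (inv-spec 1) e a Ta≈±a N signs) ⟩
      (sg N * binomial lam N) * 0#
        ≈⟨ zeroʳ _ ⟩
      0# ∎

    even-identity : ∀ lam (A : ℕ → Carrier) → IsEvenSeq R A → ∀ n →
      Σ (suc (2 ℕ.* n)) (λ k → binomial (ι (2 ℕ.* n) - lam) (suc (2 ℕ.* n) ∸ k)
                                  * binomial lam k * ι (2 ^ k) * A k) ≈ 0#
    even-identity lam A even n = begin
      Σ N (λ k → binomial (ι (2 ℕ.* n) - lam) (N ∸ k) * binomial lam k * ι (2 ^ k) * A k)
        ≈⟨ Σ-cong N (λ k → *-congʳ (*-congʳ (*-congʳ (binomial-cong shift (N ∸ k))))) ⟩
      Σ N (λ k → binomial (ι N - 1# - lam) (N ∸ k) * binomial lam k * ι (2 ^ k) * A k)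
        ≈⟨ reflected-sum-vanishes lam 0 A (λ k → trans (even k) (sym (*-identityˡ _))) N signs ⟩
      0# ∎
      where
      N : ℕ
      N = suc (2 ℕ.* n)
      shift : ι (2 ℕ.* n) - lam ≈ ι N - 1# - lam
      shift = solve 2 (λ m l → m :- l := (con (+ 1) :+ m) :- con (+ 1) :- l) refl (ι (2 ℕ.* n)) lam
      signs : 1# * - sg (2 ℕ.* n) ≈ - 1#
      signs = trans (*-identityˡ _) (-‿cong (sg-double n))

    odd-identity : ∀ lam (A : ℕ → Carrier) → IsOddSeq R A → ∀ n →
      Σ (2 ℕ.* n) (λ k → binomial (ι (2 ℕ.* n) - 1# - lam) (2 ℕ.* n ∸ k)
                          * binomial lam k * ι (2 ^ k) * A k) ≈ 0#
    odd-identity lam A odd n =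
      reflected-sum-vanishes lam 1 A (λ k → trans (odd k) (sym (-1*x≈-x _))) (2 ℕ.* n) signs
      where
      signs : - 1# * sg (2 ℕ.* n) ≈ - 1#
      signs = trans (*-congˡ (sg-double n)) (*-identityʳ _)

corollary2p7 : ∀ {c ℓ} (R : CommutativeRing c ℓ) →
    let open CommutativeRing R in
    (inv : ℕ → Carrier) → (∀ k → fromℕ R (suc k) * inv k ≈ 1#) →
    (lam : Carrier) →
    (∀ (A : ℕ → Carrier) → IsEvenSeq R A → ∀ (n : ℕ) →
      sumTo R (suc (2 ℕ.* n)) (λ k →
        binom R inv (fromℕ R (2 ℕ.* n) - lam) (suc (2 ℕ.* n) ∸ k)
          * binom R inv lam k * fromℕ R (2 ^ k) * A k) ≈ 0#)
    ×
    (∀ (A : ℕ → Carrier) → IsOddSeq R A → ∀ (n : ℕ) →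
      sumTo R (2 ℕ.* n) (λ k →
        binom R inv (fromℕ R (2 ℕ.* n) - 1# - lam) (2 ℕ.* n ∸ k)
          * binom R inv lam k * fromℕ R (2 ^ k) * A k) ≈ 0#)
corollary2p7 R inv inv-spec lam = even-identity lam , odd-identity lam
  where open BinomialTransform.GeneralisedBinomial R inv inv-spec
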